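{- For every braid word $\beta \in B_3$ there exists a context-free valence grammar $G$ (over $\mathbb{Z}$) with terminal alphabet $\Sigma = \{\sigma_1, \sigma_2, \Delta, \Delta^{ -1}\}$ such that $L(G)$ is exactly the set of all words over $\Sigma$ which, interpreted in $B_3$, are equal to $\beta$.
   Context: $B_3 = \langle \sigma_1, \sigma_2 \mid \sigma_1\sigma_2\sigma_1 = \sigma_2\sigma_1\sigma_2\rangle$ is the braid group on three strands and $\Delta = \sigma_1\sigma_2\sigma_1$ is its Garside element; a word over $\{\sigma_1,\sigma_2,\Delta,\Delta^{ -1}\}$ is interpreted as the corresponding product in $B_3$. A (context-free) valence grammar over $\mathbb{Z}^k$ is a quadruple $G = (N,\Sigma,R,S)$ where $N$ is a finite set of nonterminals, $\Sigma$ a finite set of terminals, $R \subseteq N \times (N\cup\Sigma)^* \times \mathbb{Z}^k$ a finite set of productions, and $S \in N$ the axiom. A derivation step is $(\alpha A \beta', \vec{r}) \Rightarrow (\alpha\gamma\beta', \vec{r}+\vec{x})$ whenever $(A,\gamma,\vec{x}) \in R$; $\Rightarrow^*$ is its reflexive transitive closure, and $L(G) = \{ w \in \Sigma^* : (S,\vec{0}) \Rightarrow^* (w,\vec{0})\}$. -}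

module Defs where

open import Data.Nat using (ℕ)
open import Data.Integer using (ℤ; _+_; 0ℤ)
open import Data.Fin using (Fin)
open import Data.List using (List; []; _∷_; _++_; map)
open import Data.Vec using (Vec; zipWith; replicate)
open import Data.Sum using (_⊎_; inj₁; inj₂)
open import Data.Product using (_×_; _,_)
open import Data.List.Membership.Propositional using (_∈_)
open import Relation.Binary.Construct.Closure.ReflexiveTransitive using (Star)

-- The braid group B₃ = ⟨ σ₁, σ₂ | σ₁σ₂σ₁ = σ₂σ₁σ₂ ⟩, presented as
-- words in the free-group letters σ₁^{±1}, σ₂^{±1} modulo the smallest
-- congruence containing free cancellation and the braid relation.

data Gen : Set where
  s1 s1⁻ s2 s2⁻ : Gen

inv : Gen → Gen
inv s1  = s1⁻
inv s1⁻ = s1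
inv s2  = s2⁻
inv s2⁻ = s2

BraidWord : Set
BraidWord = List Gen

data Rel : BraidWord → BraidWord → Set where
  cancel : ∀ g → Rel (g ∷ inv g ∷ []) []
  braid  : Rel (s1 ∷ s2 ∷ s1 ∷ []) (s2 ∷ s1 ∷ s2 ∷ [])

data _≈B_ : BraidWord → BraidWord → Set where
  rel   : ∀ (x u v y : BraidWord) → Rel u v → (x ++ u ++ y) ≈B (x ++ v ++ y)
  ≈refl : ∀ {u} → u ≈B u
  ≈sym  : ∀ {u v} → u ≈B v → v ≈B u
  ≈trans : ∀ {u v w} → u ≈B v → v ≈B w → u ≈B w

data Letter : Set where
  σ₁ σ₂ Δ Δ⁻¹ : Letter

interpLetter : Letter → BraidWord
interpLetter σ₁  = s1 ∷ []
interpLetter σ₂  = s2 ∷ []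
interpLetter Δ   = s1 ∷ s2 ∷ s1 ∷ []
interpLetter Δ⁻¹ = s1⁻ ∷ s2⁻ ∷ s1⁻ ∷ []

interp : List Letter → BraidWord
interp []      = []
interp (a ∷ w) = interpLetter a ++ interp w

_+ᵛ_ : ∀ {k} → Vec ℤ k → Vec ℤ k → Vec ℤ k
_+ᵛ_ = zipWith _+_

0ᵛ : ∀ {k} → Vec ℤ k
0ᵛ = replicate _ 0ℤ

record ValenceGrammar (k : ℕ) (T : Set) : Set where
  field
    n     : ℕ
    rules : List (Fin n × List (Fin n ⊎ T) × Vec ℤ k)
    start : Fin n

module _ {k : ℕ} {T : Set} (G : ValenceGrammar k T) where
  open ValenceGrammar G

  Config : Set
  Config = List (Fin n ⊎ T) × Vec ℤ k

  data Step : Config → Config → Set where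
    step : ∀ {A γ x} (α β : List (Fin n ⊎ T)) (r : Vec ℤ k) →
           (A , γ , x) ∈ rules →
           Step (α ++ inj₁ A ∷ β , r) (α ++ γ ++ β , r +ᵛ x)

  InLang : List T → Set
  InLang w = Star Step (inj₁ start ∷ [] , 0ᵛ) (map inj₂ w , 0ᵛ)

-- Modulo its centre ⟨Δ²⟩, B₃ is the modular group ℤ/3 * ℤ/2, generated by the
-- images z of σ₁Δ and y of Δ; so every braid is a reduced word in z and y times
-- a power of Δ², and two braids are equal iff their images in ℤ/3 * ℤ/2 and
-- their central powers agree.  Each letter of Σ maps to z^a y z^b, so a word of
-- Σ* has the same image as β iff its y's either cancel in matched pairs, like
-- brackets, or survive and line up with the y's of the reduced form of β's
-- image: a context-free condition.  The central power is carried by the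
-- valence: every production X → γ is weighted by the power of Δ² by which γ
-- and X differ in B₃, so a derived word equals β times Δ² to the final
-- valence, and it equals β exactly when that valence is 0, because Δ² has
-- exponent sum 6.

module Submission where

open import Algebra.Bundles using (AbelianGroup)
import Algebra.Properties.Group as GroupProperties
open import Algebra.Structures using (IsAbelianGroup)
open import Data.Bool using (Bool; true; false)
open import Data.Fin using (Fin; toℕ) renaming (zero to fzero; suc to fsuc)
open import Data.Integer using (ℤ; +_; -[1+_]; _⊖_; -_; 0ℤ; _+_; _-_; _*_)
import Data.Integer.Properties as ℤ
open import Data.List
  using (List; []; _∷_; _++_; map; length; foldr; cartesianProductWith; cartesianProduct)
open import Data.List.Membership.Propositional using (_∈_)
open import Data.List.Membership.Propositional.Properties
  using (∈-++⁺ˡ; ∈-++⁺ʳ; ∈-map⁺; ∈-cartesianProductWith⁺; ∈-cartesianProduct⁺)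
open import Data.List.NonEmpty using (List⁺; _∷_; _∷⁺_; toList; head; tail)
open import Data.List.Properties using (++-assoc; ++-identityʳ; map-++)
open import Data.List.Relation.Unary.All using (All; []; _∷_; lookup; universal)
open import Data.List.Relation.Unary.All.Properties using (++⁺; map⁺; cartesianProductWith⁺)
open import Data.List.Relation.Unary.Any using (here; there)
open import Data.Nat as ℕ using (ℕ; zero; suc; _≤_; z≤n; s≤s)
import Data.Nat.Properties as ℕ
open import Data.Product using (Σ; Σ-syntax; ∃-syntax; _×_; _,_; proj₂)
open import Data.Sum as Sum using (_⊎_; inj₁; inj₂)
open import Data.Unit using (⊤; tt)
open import Data.Vec as Vec using (Vec)
open import Data.Vec.Properties using (zipWith-assoc; zipWith-identityʳ)
open import Function using (_∘_)
open import Level using (0ℓ)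
open import Relation.Binary.Bundles using (Setoid)
open import Relation.Binary.Construct.Closure.ReflexiveTransitive using (Star; ε; _◅_; _◅◅_)
open import Relation.Binary.PropositionalEquality
  using (_≡_; refl; sym; trans; cong; cong₂; subst; subst₂; isEquivalence; module ≡-Reasoning)
import Relation.Binary.PropositionalEquality as ≡
import Relation.Binary.Reasoning.Setoid

open import Defs

data ℤ₃ : Set where
  0₃ 1₃ 2₃ : ℤ₃

suc₃ : ℤ₃ → ℤ₃
suc₃ 0₃ = 1₃
suc₃ 1₃ = 2₃
suc₃ 2₃ = 0₃

infixl 6 _+₃_ _-₃_
infix  8 -₃_

_+₃_ : ℤ₃ → ℤ₃ → ℤ₃
0₃ +₃ y = y
1₃ +₃ y = suc₃ y
2₃ +₃ y = suc₃ (suc₃ y)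

-₃_ : ℤ₃ → ℤ₃
-₃ 0₃ = 0₃
-₃ 1₃ = 2₃
-₃ 2₃ = 1₃

_-₃_ : ℤ₃ → ℤ₃ → ℤ₃
x -₃ y = x +₃ -₃ y

suc₃-+₃ : ∀ x y → suc₃ x +₃ y ≡ suc₃ (x +₃ y)
suc₃-+₃ 0₃ y  = refl
suc₃-+₃ 1₃ y  = refl
suc₃-+₃ 2₃ 0₃ = refl
suc₃-+₃ 2₃ 1₃ = refl
suc₃-+₃ 2₃ 2₃ = refl

+₃-assoc : ∀ x y z → (x +₃ y) +₃ z ≡ x +₃ (y +₃ z)
+₃-assoc 0₃ y z = refl
+₃-assoc 1₃ y z = suc₃-+₃ y z
+₃-assoc 2₃ y z = trans (suc₃-+₃ (suc₃ y) z) (cong suc₃ (suc₃-+₃ y z))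

+₃-comm : ∀ x y → x +₃ y ≡ y +₃ x
+₃-comm 0₃ 0₃ = refl
+₃-comm 0₃ 1₃ = refl
+₃-comm 0₃ 2₃ = refl
+₃-comm 1₃ 0₃ = refl
+₃-comm 1₃ 1₃ = refl
+₃-comm 1₃ 2₃ = refl
+₃-comm 2₃ 0₃ = refl
+₃-comm 2₃ 1₃ = refl
+₃-comm 2₃ 2₃ = refl

+₃-identityʳ : ∀ x → x +₃ 0₃ ≡ x
+₃-identityʳ 0₃ = refl
+₃-identityʳ 1₃ = refl
+₃-identityʳ 2₃ = refl

+₃-inverseˡ : ∀ x → -₃ x +₃ x ≡ 0₃
+₃-inverseˡ 0₃ = refl
+₃-inverseˡ 1₃ = refl
+₃-inverseˡ 2₃ = refl

+₃-inverseʳ : ∀ x → x -₃ x ≡ 0₃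
+₃-inverseʳ 0₃ = refl
+₃-inverseʳ 1₃ = refl
+₃-inverseʳ 2₃ = refl

+₃-isAbelianGroup : IsAbelianGroup _≡_ _+₃_ 0₃ (-₃_)
+₃-isAbelianGroup = record
  { isGroup = record
    { isMonoid = record
      { isSemigroup = record
        { isMagma = record { isEquivalence = isEquivalence ; ∙-cong = cong₂ _+₃_ }
        ; assoc   = +₃-assoc
        }
      ; identity = (λ _ → refl) , +₃-identityʳ
      }
    ; inverse = +₃-inverseˡ , +₃-inverseʳ
    ; ⁻¹-cong = cong (-₃_)
    }
  ; comm = +₃-comm
  }

+₃-abelianGroup : AbelianGroup 0ℓ 0ℓ
+₃-abelianGroup = record { isAbelianGroup = +₃-isAbelianGroup }

open import Algebra.Properties.CommutativeSemigroup (AbelianGroup.commutativeSemigroup +₃-abelianGroup)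
  using (xy∙z≈xz∙y; xy∙z≈x∙zy)
module +₃-Group = GroupProperties (AbelianGroup.group +₃-abelianGroup)

+₃-solveʳ : ∀ x {y z} → x +₃ y ≡ z → y ≡ -₃ x +₃ z
+₃-solveʳ x {y} {z} = +₃-Group.y≈x\\z x y z

+₃-solveˡ : ∀ {x} y {z} → x +₃ y ≡ z → x ≡ z -₃ y
+₃-solveˡ {x} y {z} = +₃-Group.x≈z//y x y z

+₃-solve-zero : ∀ {i a b k} → i +₃ b ≡ k → k +₃ a ≡ 0₃ → i ≡ -₃ (a +₃ b)
+₃-solve-zero {i} {a} {b} i+b≡k k+a≡0 = +₃-Group.inverseˡ-unique i (a +₃ b)
  (trans (sym (xy∙z≈x∙zy i b a)) (trans (cong (_+₃ a) i+b≡k) k+a≡0))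

≈B-setoid : Setoid 0ℓ 0ℓ
≈B-setoid = record
  { Carrier       = BraidWord
  ; _≈_           = _≈B_
  ; isEquivalence = record { refl = ≈refl ; sym = ≈sym ; trans = ≈trans }
  }

open Setoid ≈B-setoid using (_≈_) renaming (reflexive to ≡⇒≈)
module ≈-Reasoning = Relation.Binary.Reasoning.Setoid ≈B-setoid

≈B-cong : ∀ x y {u v} → u ≈ v → x ++ u ++ y ≈ x ++ v ++ y
≈B-cong x y (rel x′ u v y′ r) = subst₂ _≈B_ (regroup u) (regroup v) (rel (x ++ x′) u v (y′ ++ y) r)
  where
  regroup : ∀ w → (x ++ x′) ++ w ++ y′ ++ y ≡ x ++ (x′ ++ w ++ y′) ++ y
  regroup w = trans (++-assoc x x′ _)
    (cong (x ++_) (trans (cong (x′ ++_) (sym (++-assoc w y′ y))) (sym (++-assoc x′ (w ++ y′) y))))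
≈B-cong x y ≈refl        = ≈refl
≈B-cong x y (≈sym p)     = ≈sym (≈B-cong x y p)
≈B-cong x y (≈trans p q) = ≈trans (≈B-cong x y p) (≈B-cong x y q)

≈B-congˡ : ∀ x {u v} → u ≈ v → x ++ u ≈ x ++ v
≈B-congˡ x {u} {v} p =
  subst₂ (λ a b → x ++ a ≈ x ++ b) (++-identityʳ u) (++-identityʳ v) (≈B-cong x [] p)

≈B-congʳ : ∀ y {u v} → u ≈ v → u ++ y ≈ v ++ y
≈B-congʳ = ≈B-cong []

≈B-cong₂ : ∀ {u v u′ v′} → u ≈ v → u′ ≈ v′ → u ++ u′ ≈ v ++ v′
≈B-cong₂ {v = v} {u′ = u′} p q = ≈trans (≈B-congʳ u′ p) (≈B-congˡ v q)

≈B-invariant : ∀ {A : Set} (f : BraidWord → A) →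
               (∀ {u v} → Rel u v → ∀ x y → f (x ++ u ++ y) ≡ f (x ++ v ++ y)) →
               ∀ {u v} → u ≈ v → f u ≡ f v
≈B-invariant f f-rel (rel x u v y r) = f-rel r x y
≈B-invariant f f-rel ≈refl          = refl
≈B-invariant f f-rel (≈sym p)       = sym (≈B-invariant f f-rel p)
≈B-invariant f f-rel (≈trans p q)   = trans (≈B-invariant f f-rel p) (≈B-invariant f f-rel q)

Central : BraidWord → Set
Central x = ∀ u → x ++ u ≈ u ++ x

commutes-inverse : ∀ {x y ȳ} → ȳ ++ y ≈ [] → y ++ ȳ ≈ [] → x ++ y ≈ y ++ x → x ++ ȳ ≈ ȳ ++ x
commutes-inverse {x} {y} {ȳ} ȳy≈[] yȳ≈[] xy≈yx = begin
  x ++ ȳ                ≈⟨ ≈B-congʳ (x ++ ȳ) ȳy≈[] ⟨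
  (ȳ ++ y) ++ x ++ ȳ    ≡⟨ trans (++-assoc ȳ y _) (cong (ȳ ++_) (sym (++-assoc y x ȳ))) ⟩
  ȳ ++ (y ++ x) ++ ȳ    ≈⟨ ≈B-cong ȳ ȳ xy≈yx ⟨
  ȳ ++ (x ++ y) ++ ȳ    ≡⟨ trans (cong (ȳ ++_) (++-assoc x y ȳ)) (sym (++-assoc ȳ x _)) ⟩
  (ȳ ++ x) ++ y ++ ȳ    ≈⟨ ≈B-congˡ (ȳ ++ x) yȳ≈[] ⟩
  (ȳ ++ x) ++ []        ≡⟨ ++-identityʳ _ ⟩
  ȳ ++ x                ∎
  where open ≈-Reasoning

central-from-generators : ∀ {x} → (∀ g → x ++ g ∷ [] ≈ g ∷ x) → Central x
central-from-generators {x} xg≈gx []      = ≡⇒≈ (++-identityʳ x)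
central-from-generators {x} xg≈gx (g ∷ u) = begin
  x ++ g ∷ u          ≡⟨ ++-assoc x (g ∷ []) u ⟨
  (x ++ g ∷ []) ++ u  ≈⟨ ≈B-congʳ u (xg≈gx g) ⟩
  g ∷ x ++ u          ≈⟨ ≈B-congˡ (g ∷ []) (central-from-generators xg≈gx u) ⟩
  g ∷ u ++ x          ∎
  where open ≈-Reasoning

infixr 8 _^⁺_

_^⁺_ : BraidWord → ℕ → BraidWord
y ^⁺ zero  = []
y ^⁺ suc n = y ++ y ^⁺ n

^⁺-+ : ∀ y m n → y ^⁺ (m ℕ.+ n) ≡ y ^⁺ m ++ y ^⁺ n
^⁺-+ y zero    n = refl
^⁺-+ y (suc m) n = trans (cong (y ++_) (^⁺-+ y m n)) (sym (++-assoc y _ _))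

^⁺-sucʳ : ∀ y n → y ^⁺ suc n ≡ y ^⁺ n ++ y
^⁺-sucʳ y n =
  trans (cong (y ^⁺_) (ℕ.+-comm 1 n)) (trans (^⁺-+ y n 1) (cong (y ^⁺ n ++_) (++-identityʳ y)))

^⁺-central : ∀ {y} → Central y → ∀ n → Central (y ^⁺ n)
^⁺-central y-central zero u = ≈sym (≡⇒≈ (++-identityʳ u))
^⁺-central {y} y-central (suc n) u = begin
  (y ++ y ^⁺ n) ++ u   ≡⟨ ++-assoc y _ u ⟩
  y ++ y ^⁺ n ++ u     ≈⟨ ≈B-congˡ y (^⁺-central y-central n u) ⟩
  y ++ u ++ y ^⁺ n     ≡⟨ ++-assoc y u _ ⟨
  (y ++ u) ++ y ^⁺ n   ≈⟨ ≈B-congʳ _ (y-central u) ⟩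
  (u ++ y) ++ y ^⁺ n   ≡⟨ ++-assoc u y _ ⟩
  u ++ y ^⁺ suc n      ∎
  where open ≈-Reasoning

zpow : BraidWord → BraidWord → ℤ → BraidWord
zpow y ȳ (+ n)    = y ^⁺ n
zpow y ȳ -[1+ n ] = ȳ ^⁺ suc n

zpow-swap : ∀ y ȳ c → zpow ȳ y c ≡ zpow y ȳ (- c)
zpow-swap y ȳ (+ zero)  = refl
zpow-swap y ȳ (+ suc n) = refl
zpow-swap y ȳ -[1+ n ]  = refl

^⁺-cancel : ∀ {y ȳ} → y ++ ȳ ≈ [] → ∀ m n → y ^⁺ m ++ ȳ ^⁺ n ≈ zpow y ȳ (m ⊖ n)
^⁺-cancel {y} yȳ≈[] m       zero    = ≡⇒≈ (++-identityʳ (y ^⁺ m))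
^⁺-cancel     yȳ≈[] zero    (suc n) = ≈refl
^⁺-cancel {y} {ȳ} yȳ≈[] (suc m) (suc n) = begin
  y ^⁺ suc m ++ ȳ ^⁺ suc n      ≡⟨ cong (_++ ȳ ^⁺ suc n) (^⁺-sucʳ y m) ⟩
  (y ^⁺ m ++ y) ++ ȳ ++ ȳ ^⁺ n  ≡⟨ ++-assoc (y ^⁺ m) y _ ⟩
  y ^⁺ m ++ y ++ ȳ ++ ȳ ^⁺ n    ≡⟨ cong (y ^⁺ m ++_) (++-assoc y ȳ _) ⟨
  y ^⁺ m ++ (y ++ ȳ) ++ ȳ ^⁺ n  ≈⟨ ≈B-cong (y ^⁺ m) (ȳ ^⁺ n) yȳ≈[] ⟩
  y ^⁺ m ++ ȳ ^⁺ n              ≈⟨ ^⁺-cancel yȳ≈[] m n ⟩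
  zpow y ȳ (m ⊖ n)              ≡⟨ cong (zpow y ȳ) (ℤ.[1+m]⊖[1+n]≡m⊖n m n) ⟨
  zpow y ȳ (suc m ⊖ suc n)      ∎
  where open ≈-Reasoning

module _ {y ȳ : BraidWord} (yȳ≈[] : y ++ ȳ ≈ []) (ȳy≈[] : ȳ ++ y ≈ []) where

  zpow-+ : ∀ a b → zpow y ȳ a ++ zpow y ȳ b ≈ zpow y ȳ (a + b)
  zpow-+ (+ m)    (+ n)    = ≈sym (≡⇒≈ (^⁺-+ y m n))
  zpow-+ (+ m)    -[1+ n ] = ^⁺-cancel yȳ≈[] m (suc n)
  zpow-+ -[1+ m ] (+ n)    = begin
    ȳ ^⁺ suc m ++ y ^⁺ n      ≈⟨ ^⁺-cancel ȳy≈[] (suc m) n ⟩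
    zpow ȳ y (suc m ⊖ n)      ≡⟨ zpow-swap y ȳ (suc m ⊖ n) ⟩
    zpow y ȳ (- (suc m ⊖ n))  ≡⟨ cong (zpow y ȳ) (ℤ.⊖-swap n (suc m)) ⟨
    zpow y ȳ (n ⊖ suc m)      ∎
    where open ≈-Reasoning
  zpow-+ -[1+ m ] -[1+ n ] = ≈sym (≡⇒≈
    (trans (cong (λ k → ȳ ^⁺ suc k) (sym (ℕ.+-suc m n))) (^⁺-+ ȳ (suc m) (suc n))))

  zpow-central : Central y → ∀ c → Central (zpow y ȳ c)
  zpow-central y-central (+ n)    = ^⁺-central y-central n
  zpow-central y-central -[1+ n ] = ^⁺-central ȳ-central (suc n)
    where
    ȳ-central : Central ȳ
    ȳ-central u = ≈sym (commutes-inverse {x = u} ȳy≈[] yȳ≈[] (≈sym (y-central u)))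

garside garside⁻¹ center center⁻¹ : BraidWord
garside   = s1 ∷ s2 ∷ s1 ∷ []
garside⁻¹ = s1⁻ ∷ s2⁻ ∷ s1⁻ ∷ []
center    = garside ++ garside
center⁻¹  = garside⁻¹ ++ garside⁻¹

garside-inverseʳ : garside ++ garside⁻¹ ≈ []
garside-inverseʳ = ≈trans (rel (s1 ∷ s2 ∷ []) _ _ (s2⁻ ∷ s1⁻ ∷ []) (cancel s1))
  (≈trans (rel (s1 ∷ []) _ _ (s1⁻ ∷ []) (cancel s2)) (rel [] _ _ [] (cancel s1)))

garside-inverseˡ : garside⁻¹ ++ garside ≈ []
garside-inverseˡ = ≈trans (rel (s1⁻ ∷ s2⁻ ∷ []) _ _ (s2 ∷ s1 ∷ []) (cancel s1⁻))
  (≈trans (rel (s1⁻ ∷ []) _ _ (s1 ∷ []) (cancel s2⁻)) (rel [] _ _ [] (cancel s1⁻)))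

garside³-inverse : garside ++ garside ++ garside ++ garside⁻¹ ++ garside⁻¹ ++ garside⁻¹ ≈ []
garside³-inverse = ≈trans (≈B-cong (garside ++ garside) (garside⁻¹ ++ garside⁻¹) garside-inverseʳ)
  (≈trans (≈B-cong garside garside⁻¹ garside-inverseʳ) garside-inverseʳ)

garside-s1 : garside ++ s1 ∷ [] ≈ s2 ∷ garside
garside-s1 = rel [] _ _ (s1 ∷ []) braid

garside-s2 : garside ++ s2 ∷ [] ≈ s1 ∷ garside
garside-s2 = ≈sym (rel (s1 ∷ []) _ _ [] braid)

center-inverseʳ : center ++ center⁻¹ ≈ []
center-inverseʳ = ≈trans (≈B-cong garside garside⁻¹ garside-inverseʳ) garside-inverseʳ

center-inverseˡ : center⁻¹ ++ center ≈ []
center-inverseˡ = ≈trans (≈B-cong garside⁻¹ garside garside-inverseˡ) garside-inverseˡ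

center-central : Central center
center-central = central-from-generators center-commutes
  where
  center-s1 : center ++ s1 ∷ [] ≈ s1 ∷ center
  center-s1 = ≈trans (≈B-congˡ garside garside-s1) (≈B-congʳ garside garside-s2)
  center-s2 : center ++ s2 ∷ [] ≈ s2 ∷ center
  center-s2 = ≈trans (≈B-congˡ garside garside-s2) (≈B-congʳ garside garside-s1)
  center-commutes : ∀ g → center ++ g ∷ [] ≈ g ∷ center
  center-commutes s1  = center-s1
  center-commutes s2  = center-s2
  center-commutes s1⁻ = commutes-inverse {center} {s1 ∷ []} {s1⁻ ∷ []}
    (rel [] _ _ [] (cancel s1⁻)) (rel [] _ _ [] (cancel s1)) center-s1
  center-commutes s2⁻ = commutes-inverse {center} {s2 ∷ []} {s2⁻ ∷ []}
    (rel [] _ _ [] (cancel s2⁻)) (rel [] _ _ [] (cancel s2)) center-s2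

center^ : ℤ → BraidWord
center^ = zpow center center⁻¹

center^-+ : ∀ a b → center^ a ++ center^ b ≈ center^ (a + b)
center^-+ = zpow-+ center-inverseʳ center-inverseˡ

center^-central : ∀ c → Central (center^ c)
center^-central = zpow-central center-inverseʳ center-inverseˡ center-central

module +-Group = GroupProperties (AbelianGroup.group ℤ.+-0-abelianGroup)

exponent : Gen → ℤ
exponent s1  = + 1
exponent s2  = + 1
exponent s1⁻ = -[1+ 0 ]
exponent s2⁻ = -[1+ 0 ]

exponentSum : BraidWord → ℤ
exponentSum []      = 0ℤ
exponentSum (g ∷ u) = exponent g + exponentSum u

exponentSum-++ : ∀ u v → exponentSum (u ++ v) ≡ exponentSum u + exponentSum v
exponentSum-++ []      v = sym (ℤ.+-identityˡ (exponentSum v))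
exponentSum-++ (g ∷ u) v =
  trans (cong (_+_ (exponent g)) (exponentSum-++ u v)) (sym (ℤ.+-assoc (exponent g) _ _))

exponentSum-≈ : ∀ {u v} → u ≈ v → exponentSum u ≡ exponentSum v
exponentSum-≈ = ≈B-invariant exponentSum in-context
  where
  open ≡-Reasoning
  relator : ∀ {u v} → Rel u v → exponentSum u ≡ exponentSum v
  relator (cancel s1)  = refl
  relator (cancel s1⁻) = refl
  relator (cancel s2)  = refl
  relator (cancel s2⁻) = refl
  relator braid        = refl
  in-context : ∀ {u v} → Rel u v → ∀ x y → exponentSum (x ++ u ++ y) ≡ exponentSum (x ++ v ++ y)
  in-context {u} {v} r x y = begin
    exponentSum (x ++ u ++ y)                        ≡⟨ exponentSum-++ x _ ⟩
    exponentSum x + exponentSum (u ++ y)             ≡⟨ cong (_+_ (exponentSum x)) (exponentSum-++ u y) ⟩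
    exponentSum x + (exponentSum u + exponentSum y)  ≡⟨ cong (λ n → exponentSum x + (n + _)) (relator r) ⟩
    exponentSum x + (exponentSum v + exponentSum y)  ≡⟨ cong (_+_ (exponentSum x)) (exponentSum-++ v y) ⟨
    exponentSum x + exponentSum (v ++ y)             ≡⟨ exponentSum-++ x _ ⟨
    exponentSum (x ++ v ++ y)                        ∎

exponentSum-^⁺ : ∀ y n → exponentSum (y ^⁺ n) ≡ + n * exponentSum y
exponentSum-^⁺ y zero    = refl
exponentSum-^⁺ y (suc n) = begin
  exponentSum (y ++ y ^⁺ n)             ≡⟨ exponentSum-++ y (y ^⁺ n) ⟩
  exponentSum y + exponentSum (y ^⁺ n)  ≡⟨ cong (_+_ (exponentSum y)) (exponentSum-^⁺ y n) ⟩
  exponentSum y + + n * exponentSum y   ≡⟨ ℤ.suc-* (+ n) (exponentSum y) ⟨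
  + suc n * exponentSum y               ∎
  where open ≡-Reasoning

exponentSum-zpow : ∀ y ȳ → exponentSum ȳ ≡ - exponentSum y →
                   ∀ c → exponentSum (zpow y ȳ c) ≡ c * exponentSum y
exponentSum-zpow y ȳ ȳ≡-y (+ n)    = exponentSum-^⁺ y n
exponentSum-zpow y ȳ ȳ≡-y -[1+ n ] = begin
  exponentSum (ȳ ^⁺ suc n)     ≡⟨ exponentSum-^⁺ ȳ (suc n) ⟩
  + suc n * exponentSum ȳ      ≡⟨ cong (_*_ (+ suc n)) ȳ≡-y ⟩
  + suc n * - exponentSum y    ≡⟨ ℤ.neg-distribʳ-* (+ suc n) (exponentSum y) ⟨
  - (+ suc n * exponentSum y)  ≡⟨ ℤ.neg-distribˡ-* (+ suc n) (exponentSum y) ⟩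
  -[1+ n ] * exponentSum y     ∎
  where open ≡-Reasoning

center^-cancelʳ : ∀ u c → u ++ center^ c ≈ u → c ≡ 0ℤ
center^-cancelʳ u c u·Δ²ᶜ≈u =
  ℤ.*-cancelʳ-≡ c 0ℤ (+ 6) (+-Group.∙-cancelˡ (exponentSum u) (c * + 6) (0ℤ * + 6) (begin
  exponentSum u + c * + 6                  ≡⟨ cong (_+_ (exponentSum u)) (exponentSum-zpow _ _ refl c) ⟨
  exponentSum u + exponentSum (center^ c)  ≡⟨ exponentSum-++ u (center^ c) ⟨
  exponentSum (u ++ center^ c)             ≡⟨ exponentSum-≈ u·Δ²ᶜ≈u ⟩
  exponentSum u                            ≡⟨ ℤ.+-identityʳ _ ⟨
  exponentSum u + 0ℤ * + 6                 ∎))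
  where open ≡-Reasoning

-- The modular group ℤ/3 * ℤ/2 = B₃ / ⟨Δ²⟩

-- Reduced b: the reduced words z^a₀ y z^a₁ y ⋯ y z^aₙ (inner aᵢ ≠ 0), read from
-- the left; b records whether the word begins with y.
data Reduced : Bool → Set where
  z^_      : ℤ₃ → Reduced false
  y∷_      : Reduced false → Reduced true
  z∷_ z²∷_ : Reduced true → Reduced false

Modular : Set
Modular = Σ Bool Reduced

one : Modular
one = false , z^ 0₃

z· y· : Modular → Modular
z· (false , z^ 0₃) = false , z^ 1₃
z· (false , z^ 1₃) = false , z^ 2₃
z· (false , z^ 2₃) = false , z^ 0₃
z· (false , z∷ r)  = false , z²∷ r
z· (false , z²∷ r) = true , r
z· (true , r)      = false , z∷ r
y· (false , r)     = true , y∷ r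
y· (true , y∷ r)   = false , r

y·-involutive : ∀ e → y· (y· e) ≡ e
y·-involutive (false , r)   = refl
y·-involutive (true , y∷ r) = refl

z·-cube : ∀ e → z· (z· (z· e)) ≡ e
z·-cube (false , z^ 0₃)    = refl
z·-cube (false , z^ 1₃)    = refl
z·-cube (false , z^ 2₃)    = refl
z·-cube (false , z∷ y∷ r)  = refl
z·-cube (false , z²∷ y∷ r) = refl
z·-cube (true , y∷ r)      = refl

z^· : ℤ₃ → Modular → Modular
z^· 0₃ e = e
z^· 1₃ e = z· e
z^· 2₃ e = z· (z· e)

z^·-+ : ∀ a b e → z^· a (z^· b e) ≡ z^· (a +₃ b) e
z^·-+ 0₃ b  e = refl
z^·-+ 1₃ 0₃ e = refl
z^·-+ 1₃ 1₃ e = refl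
z^·-+ 1₃ 2₃ e = z·-cube e
z^·-+ 2₃ 0₃ e = refl
z^·-+ 2₃ 1₃ e = z·-cube e
z^·-+ 2₃ 2₃ e = cong z· (z·-cube e)

-- the exponents a₀ ∷ a₁ ∷ ⋯ ∷ aₙ of the reduced word
blocks : Modular → List⁺ ℤ₃
blocks (false , z^ k)  = k ∷ []
blocks (true , y∷ r)   = 0₃ ∷⁺ blocks (false , r)
blocks (false , z∷ r)  = 1₃ ∷ tail (blocks (true , r))
blocks (false , z²∷ r) = 2₃ ∷ tail (blocks (true , r))

blocks-z· : ∀ e → blocks (z· e) ≡ head (blocks e) +₃ 1₃ ∷ tail (blocks e)
blocks-z· (false , z^ 0₃)    = refl
blocks-z· (false , z^ 1₃)    = refl
blocks-z· (false , z^ 2₃)    = refl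
blocks-z· (false , z∷ r)     = refl
blocks-z· (false , z²∷ y∷ r) = refl
blocks-z· (true , y∷ r)      = refl

blocks-z^· : ∀ k e → blocks (z^· k e) ≡ head (blocks e) +₃ k ∷ tail (blocks e)
blocks-z^· 0₃ e = cong (_∷ tail (blocks e)) (sym (+₃-identityʳ _))
blocks-z^· 1₃ e = blocks-z· e
blocks-z^· 2₃ e = begin
  blocks (z· (z· e))
    ≡⟨ blocks-z· (z· e) ⟩
  head (blocks (z· e)) +₃ 1₃ ∷ tail (blocks (z· e))
    ≡⟨ cong (λ bs → head bs +₃ 1₃ ∷ tail bs) (blocks-z· e) ⟩
  head (blocks e) +₃ 1₃ +₃ 1₃ ∷ tail (blocks e)
    ≡⟨ cong (_∷ tail (blocks e)) (+₃-assoc (head (blocks e)) 1₃ 1₃) ⟩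
  head (blocks e) +₃ 2₃ ∷ tail (blocks e)
    ∎
  where open ≡-Reasoning

data YView (e : Modular) : Set where
  y-cancels : ∀ {k ks} → blocks e ≡ 0₃ ∷ k ∷ ks → blocks (y· e) ≡ k ∷ ks → YView e
  y-pushed  : blocks (y· e) ≡ 0₃ ∷⁺ blocks e → YView e

y·-view : ∀ e → YView e
y·-view (true , y∷ r) = y-cancels refl refl
y·-view (false , r)   = y-pushed refl

data Syllable : Set where
  Z Y : Syllable

syllable· : Syllable → Modular → Modular
syllable· Z = z·
syllable· Y = y·

syllableWord : Syllable → BraidWord
syllableWord Z = s1 ∷ garside
syllableWord Y = garside

syllablesWord : List Syllable → BraidWord
syllablesWord = foldr (λ c w → syllableWord c ++ w) []

zWord : ℤ₃ → BraidWord
zWord 0₃ = []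
zWord 1₃ = syllableWord Z
zWord 2₃ = syllableWord Z ++ syllableWord Z

tailWord : List ℤ₃ → BraidWord
tailWord []       = []
tailWord (k ∷ ks) = syllableWord Y ++ zWord k ++ tailWord ks

blockWord : ℤ₃ → List ℤ₃ → BraidWord
blockWord k ks = zWord k ++ tailWord ks

word : Modular → BraidWord
word e = blockWord (head (blocks e)) (tail (blocks e))

Z³≈center² : syllableWord Z ++ syllableWord Z ++ syllableWord Z ≈ center ++ center
Z³≈center² = ≈trans (≈B-cong (s1 ∷ []) (garside ++ s1 ∷ garside) garside-s1)
                    (≈B-cong (s1 ∷ s2 ∷ []) garside (center-central (s1 ∷ [])))

carry : Syllable → Modular → ℤ
carry Z (false , z^ 0₃) = 0ℤ
carry Z (false , z^ 1₃) = 0ℤ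
carry Z (false , z^ 2₃) = + 2
carry Z (false , z∷ r)  = 0ℤ
carry Z (false , z²∷ r) = + 2
carry Z (true , r)      = 0ℤ
carry Y (false , r)     = 0ℤ
carry Y (true , r)      = + 1

syllable-normal : ∀ c e → syllableWord c ++ word e ≈ word (syllable· c e) ++ center^ (carry c e)
syllable-normal Z (false , z^ 0₃)    = ≈refl
syllable-normal Z (false , z^ 1₃)    = ≈refl
syllable-normal Z (false , z^ 2₃)    = Z³≈center²
syllable-normal Z (false , z∷ y∷ r)  = ≡⇒≈ (sym (++-identityʳ _))
syllable-normal Z (false , z²∷ y∷ r) =
  ≈trans (≈B-congʳ (word (true , y∷ r)) Z³≈center²) (center^-central (+ 2) (word (true , y∷ r)))
syllable-normal Z (true , y∷ r)      = ≡⇒≈ (sym (++-identityʳ _))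
syllable-normal Y (false , r)        = ≡⇒≈ (sym (++-identityʳ _))
syllable-normal Y (true , y∷ r)      = center^-central (+ 1) (word (false , r))

carries : List Syllable → Modular → ℤ
carries []       e = 0ℤ
carries (c ∷ cs) e = carry c (foldr syllable· e cs) + carries cs e

syllables-normal : ∀ cs e →
                   syllablesWord cs ++ word e ≈ word (foldr syllable· e cs) ++ center^ (carries cs e)
syllables-normal []       e = ≡⇒≈ (sym (++-identityʳ (word e)))
syllables-normal (c ∷ cs) e = begin
  (syllableWord c ++ syllablesWord cs) ++ word e  ≡⟨ ++-assoc (syllableWord c) _ _ ⟩
  syllableWord c ++ syllablesWord cs ++ word e    ≈⟨ ≈B-congˡ (syllableWord c) (syllables-normal cs e) ⟩
  syllableWord c ++ word e′ ++ center^ n          ≡⟨ ++-assoc (syllableWord c) _ _ ⟨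
  (syllableWord c ++ word e′) ++ center^ n        ≈⟨ ≈B-congʳ (center^ n) (syllable-normal c e′) ⟩
  (word e″ ++ center^ n′) ++ center^ n            ≡⟨ ++-assoc (word e″) _ _ ⟩
  word e″ ++ center^ n′ ++ center^ n              ≈⟨ ≈B-congˡ (word e″) (center^-+ n′ n) ⟩
  word e″ ++ center^ (n′ + n)                     ∎
  where
  open ≈-Reasoning
  e′ = foldr syllable· e cs
  e″ = syllable· c e′
  n  = carries cs e
  n′ = carry c e′

syllables : Gen → List Syllable
syllables s1  = Z ∷ Y ∷ []
syllables s2  = Y ∷ Z ∷ []
syllables s1⁻ = Y ∷ Z ∷ Z ∷ []
syllables s2⁻ = Z ∷ Z ∷ Y ∷ []

offset : Gen → ℤ
offset s1  = -[1+ 0 ]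
offset s2  = -[1+ 0 ]
offset s1⁻ = -[1+ 1 ]
offset s2⁻ = -[1+ 1 ]

syllables-generator : ∀ g → syllablesWord (syllables g) ++ center^ (offset g) ≈ g ∷ []
syllables-generator s1  = ≈B-congˡ (s1 ∷ []) center-inverseʳ
syllables-generator s2  =
  ≈trans (≈B-congʳ (garside ++ center⁻¹) garside-s1) (≈B-congˡ (s2 ∷ []) center-inverseʳ)
syllables-generator s1⁻ = begin
  garside ++ s1 ∷ garside ++ s1 ∷ garside ++ center⁻¹ ++ center⁻¹
    ≈⟨ ≈B-congʳ (garside ++ s1 ∷ garside ++ center⁻¹ ++ center⁻¹) garside-s1 ⟩
  s2 ∷ center ++ s1 ∷ garside ++ center⁻¹ ++ center⁻¹
    ≈⟨ ≈B-cong (s2 ∷ []) (garside ++ center⁻¹ ++ center⁻¹) (center-central (s1 ∷ [])) ⟩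
  s2 ∷ s1 ∷ garside ++ garside ++ garside ++ garside⁻¹ ++ garside⁻¹ ++ garside⁻¹ ++ garside⁻¹
    ≈⟨ ≈B-cong (s2 ∷ s1 ∷ []) garside⁻¹ garside³-inverse ⟩
  s2 ∷ s1 ∷ garside⁻¹
    ≈⟨ rel (s2 ∷ []) _ _ (s2⁻ ∷ s1⁻ ∷ []) (cancel s1) ⟩
  s2 ∷ s2⁻ ∷ s1⁻ ∷ []
    ≈⟨ rel [] _ _ (s1⁻ ∷ []) (cancel s2) ⟩
  s1⁻ ∷ []
    ∎
  where open ≈-Reasoning
syllables-generator s2⁻ = begin
  s1 ∷ garside ++ s1 ∷ garside ++ garside ++ center⁻¹ ++ center⁻¹
    ≈⟨ ≈B-cong (s1 ∷ []) (garside ++ garside ++ center⁻¹ ++ center⁻¹) garside-s1 ⟩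
  s1 ∷ s2 ∷ garside ++ garside ++ garside ++ garside⁻¹ ++ garside⁻¹ ++ garside⁻¹ ++ garside⁻¹
    ≈⟨ ≈B-cong (s1 ∷ s2 ∷ []) garside⁻¹ garside³-inverse ⟩
  s1 ∷ s2 ∷ garside⁻¹
    ≈⟨ rel [] _ _ (s1 ∷ s2 ∷ garside⁻¹) (cancel s2⁻) ⟨
  s2⁻ ∷ s2 ∷ s1 ∷ s2 ∷ garside⁻¹
    ≈⟨ rel (s2⁻ ∷ []) _ _ garside⁻¹ braid ⟨
  s2⁻ ∷ garside ++ garside⁻¹
    ≈⟨ ≈B-congˡ (s2⁻ ∷ []) garside-inverseʳ ⟩
  s2⁻ ∷ []
    ∎
  where open ≈-Reasoning

act : BraidWord → Modular → Modular
act []      e = e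
act (g ∷ u) e = foldr syllable· (act u e) (syllables g)

image : BraidWord → Modular
image u = act u one

act-++ : ∀ u v e → act (u ++ v) e ≡ act u (act v e)
act-++ []      v e = refl
act-++ (g ∷ u) v e = cong (λ e′ → foldr syllable· e′ (syllables g)) (act-++ u v e)

act-garside : ∀ e → act garside e ≡ y· e
act-garside e = trans (cong z· (y·-involutive (z· (z· (y· e))))) (z·-cube (y· e))

act-≈ : ∀ {u v} → u ≈ v → ∀ e → act u e ≡ act v e
act-≈ u≈v e = ≈B-invariant (λ u → act u e) in-context u≈v
  where
  open ≡-Reasoning
  relator : ∀ {u v} → Rel u v → ∀ e → act u e ≡ act v e
  relator (cancel s1)  e = trans (cong z· (y·-involutive (z· (z· e)))) (z·-cube e)
  relator (cancel s1⁻) e = trans (cong y· (z·-cube (y· e))) (y·-involutive e)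
  relator (cancel s2)  e = trans (cong y· (z·-cube (y· e))) (y·-involutive e)
  relator (cancel s2⁻) e = trans (cong (λ e′ → z· (z· e′)) (y·-involutive (z· e))) (z·-cube e)
  relator braid        e = trans (act-garside e)
    (sym (trans (cong (λ e′ → y· (z· (z· e′))) (y·-involutive (z· e))) (cong y· (z·-cube e))))
  in-context : ∀ {u v} → Rel u v → ∀ x y → act (x ++ u ++ y) e ≡ act (x ++ v ++ y) e
  in-context {u} {v} r x y = begin
    act (x ++ u ++ y) e      ≡⟨ act-++ x _ e ⟩
    act x (act (u ++ y) e)   ≡⟨ cong (act x) (act-++ u y e) ⟩
    act x (act u (act y e))  ≡⟨ cong (act x) (relator r (act y e)) ⟩
    act x (act v (act y e))  ≡⟨ cong (act x) (act-++ v y e) ⟨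
    act x (act (v ++ y) e)   ≡⟨ act-++ x _ e ⟨
    act (x ++ v ++ y) e      ∎

centralPart : BraidWord → ℤ
centralPart []      = 0ℤ
centralPart (g ∷ u) = carries (syllables g) (image u) + (offset g + centralPart u)

normal-form : ∀ u → u ≈ word (image u) ++ center^ (centralPart u)
normal-form []      = ≈refl
normal-form (g ∷ u) = begin
  g ∷ u
    ≈⟨ ≈B-cong₂ (≈sym (syllables-generator g)) (normal-form u) ⟩
  (syllablesWord cs ++ center^ o) ++ word e ++ center^ c
    ≡⟨ ++-assoc (syllablesWord cs) _ _ ⟩
  syllablesWord cs ++ center^ o ++ word e ++ center^ c
    ≈⟨ ≈B-congˡ (syllablesWord cs) (center^-past o (word e)) ⟩
  syllablesWord cs ++ word e ++ center^ o ++ center^ c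
    ≡⟨ ++-assoc (syllablesWord cs) _ _ ⟨
  (syllablesWord cs ++ word e) ++ center^ o ++ center^ c
    ≈⟨ ≈B-cong₂ (syllables-normal cs e) (center^-+ o c) ⟩
  (word e′ ++ center^ n) ++ center^ (o + c)
    ≡⟨ ++-assoc (word e′) _ _ ⟩
  word e′ ++ center^ n ++ center^ (o + c)
    ≈⟨ ≈B-congˡ (word e′) (center^-+ n (o + c)) ⟩
  word e′ ++ center^ (n + (o + c))
    ∎
  where
  open ≈-Reasoning
  cs = syllables g
  o  = offset g
  e  = image u
  c  = centralPart u
  e′ = foldr syllable· e cs
  n  = carries cs e
  center^-past : ∀ a v → center^ a ++ v ++ center^ c ≈ v ++ center^ a ++ center^ c
  center^-past a v = begin
    center^ a ++ v ++ center^ c    ≡⟨ ++-assoc (center^ a) v _ ⟨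
    (center^ a ++ v) ++ center^ c  ≈⟨ ≈B-congʳ (center^ c) (center^-central a v) ⟩
    (v ++ center^ a) ++ center^ c  ≡⟨ ++-assoc v _ _ ⟩
    v ++ center^ a ++ center^ c    ∎

image-≡⇒≈ : ∀ u v → image u ≡ image v → u ≈ v ++ center^ (centralPart u - centralPart v)
image-≡⇒≈ u v image-u≡image-v = begin
  u
    ≈⟨ normal-form u ⟩
  word (image u) ++ center^ a
    ≡⟨ cong₂ (λ e n → word e ++ center^ n) image-u≡image-v (sym b+d≡a) ⟩
  word (image v) ++ center^ (b + d)
    ≈⟨ ≈B-congˡ (word (image v)) (center^-+ b d) ⟨
  word (image v) ++ center^ b ++ center^ d
    ≡⟨ ++-assoc (word (image v)) _ _ ⟨
  (word (image v) ++ center^ b) ++ center^ d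
    ≈⟨ ≈B-congʳ (center^ d) (normal-form v) ⟨
  v ++ center^ d
    ∎
  where
  open ≈-Reasoning
  a = centralPart u
  b = centralPart v
  d = a - b
  b+d≡a : b + d ≡ a
  b+d≡a = trans (ℤ.+-comm b d) (+-Group.//-rightDividesˡ b a)

act-syllableWord : ∀ c e → act (syllableWord c) e ≡ syllable· c e
act-syllableWord Z e = trans (cong (λ e′ → z· (y· e′)) (act-garside e)) (cong z· (y·-involutive e))
act-syllableWord Y e = act-garside e

act-zWord : ∀ k e → act (zWord k) e ≡ z^· k e
act-zWord 0₃ e = refl
act-zWord 1₃ e = act-syllableWord Z e
act-zWord 2₃ e = trans (act-++ (syllableWord Z) (syllableWord Z) e)
  (trans (act-syllableWord Z (act (syllableWord Z) e)) (cong z· (act-syllableWord Z e)))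

act-blockWord : ∀ a ks e → act (blockWord a ks) e ≡ z^· a (act (tailWord ks) e)
act-blockWord a ks e = trans (act-++ (zWord a) (tailWord ks) e) (act-zWord a _)

image-word : ∀ e → image (word e) ≡ e
image-word (false , z^ 0₃)    = refl
image-word (false , z^ 1₃)    = act-syllableWord Z one
image-word (false , z^ 2₃)    = act-zWord 2₃ one
image-word (true , y∷ r)      = trans (act-++ (syllableWord Y) (word (false , r)) one)
  (trans (act-syllableWord Y _) (cong y· (image-word (false , r))))
image-word (false , z∷ y∷ r)  = trans (act-++ (zWord 1₃) (word (true , y∷ r)) one)
  (trans (act-zWord 1₃ _) (cong z· (image-word (true , y∷ r))))
image-word (false , z²∷ y∷ r) = trans (act-++ (zWord 2₃) (word (true , y∷ r)) one)
  (trans (act-zWord 2₃ _) (cong (z^· 2₃) (image-word (true , y∷ r))))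

lead trail : Letter → ℤ₃
lead σ₁  = 1₃
lead σ₂  = 0₃
lead Δ   = 0₃
lead Δ⁻¹ = 0₃
trail σ₁  = 0₃
trail σ₂  = 1₃
trail Δ   = 0₃
trail Δ⁻¹ = 0₃

letter· : Letter → Modular → Modular
letter· ℓ e = z^· (lead ℓ) (y· (z^· (trail ℓ) e))

act-letter : ∀ ℓ e → act (interpLetter ℓ) e ≡ letter· ℓ e
act-letter σ₁  e = refl
act-letter σ₂  e = refl
act-letter Δ   e = act-garside e
act-letter Δ⁻¹ e = trans (cong (λ e′ → y· (z· (z· (z· (z· e′))))) (y·-involutive (z· (z· e))))
  (trans (cong (λ e′ → y· (z· (z· (z· e′)))) (z·-cube e)) (cong y· (z·-cube e)))

-- Balanced k w: the letters of w are matched like brackets, each matched pair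
-- ℓ ⋯ ℓ′ cancelling as y z^(trail ℓ) z^i z^(lead ℓ′) y = 1; then w has image z^k.
data Balanced : ℤ₃ → List Letter → Set where
  []   : Balanced 0₃ []
  pair : ∀ {ℓ ℓ′ v v′ j} → Balanced (-₃ (trail ℓ +₃ lead ℓ′)) v → Balanced j v′ →
         Balanced (lead ℓ +₃ trail ℓ′ +₃ j) (ℓ ∷ v ++ ℓ′ ∷ v′)

-- Parse p w (k ∷ ks): z^p · image w has blocks k ∷ ks, the letters of w whose
-- y survives being the ones displayed by next.
data Parse : ℤ₃ → List Letter → List⁺ ℤ₃ → Set where
  last : ∀ {p i w k} → Balanced i w → p +₃ i ≡ k → Parse p w (k ∷ [])
  next : ∀ {p i v ℓ w k k′ ks} → Balanced i v → p +₃ i +₃ lead ℓ ≡ k →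
         Parse (trail ℓ) w (k′ ∷ ks) → Parse p (v ++ ℓ ∷ w) (k ∷ k′ ∷ ks)

parse-shift : ∀ d {p w k ks} → Parse p w (k ∷ ks) → Parse (p +₃ d) w (k +₃ d ∷ ks)
parse-shift d {p} (last {i = i} b p+i≡k) = last b (trans (xy∙z≈xz∙y p d i) (cong (_+₃ d) p+i≡k))
parse-shift d {p} (next {i = i} {ℓ = ℓ} {k = k} b p+i+l≡k π) = next b (begin
  p +₃ d +₃ i +₃ lead ℓ  ≡⟨ cong (_+₃ lead ℓ) (xy∙z≈xz∙y p d i) ⟩
  p +₃ i +₃ d +₃ lead ℓ  ≡⟨ xy∙z≈xz∙y (p +₃ i) d (lead ℓ) ⟩
  p +₃ i +₃ lead ℓ +₃ d  ≡⟨ cong (_+₃ d) p+i+l≡k ⟩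
  k +₃ d                 ∎) π
  where open ≡-Reasoning

parse-push : ∀ ℓ {w k ks} → Parse 0₃ w (k ∷ ks) →
             Parse 0₃ (ℓ ∷ w) (lead ℓ ∷ k +₃ trail ℓ ∷ ks)
parse-push ℓ π = next [] refl (parse-shift (trail ℓ) π)

parse-pop : ∀ ℓ {w k k₁ ks} → k +₃ trail ℓ ≡ 0₃ →
            Parse 0₃ w (k ∷ k₁ ∷ ks) → Parse 0₃ (ℓ ∷ w) (k₁ +₃ lead ℓ ∷ ks)
parse-pop ℓ {k₁ = k₁} k+t≡0 (next b₀ i₀+l₁≡k (last {p = t₁} {i = i₁} b₁ t₁+i₁≡k₁)) =
  last (pair (subst (λ i → Balanced i _) (+₃-solve-zero i₀+l₁≡k k+t≡0) b₀) b₁) (begin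
    lead ℓ +₃ t₁ +₃ i₁    ≡⟨ +₃-assoc (lead ℓ) t₁ i₁ ⟩
    lead ℓ +₃ (t₁ +₃ i₁)  ≡⟨ cong (lead ℓ +₃_) t₁+i₁≡k₁ ⟩
    lead ℓ +₃ k₁          ≡⟨ +₃-comm (lead ℓ) k₁ ⟩
    k₁ +₃ lead ℓ          ∎)
  where open ≡-Reasoning
parse-pop ℓ {k₁ = k₁} k+t≡0
          (next {v = v₀} {ℓ = ℓ₁} b₀ i₀+l₁≡k
                (next {p = t₁} {i = i₁} {v = v₁} {ℓ = ℓ₂} {w = w} b₁ t₁+i₁+l₂≡k₁ π)) =
  subst (λ u → Parse 0₃ (ℓ ∷ u) _) (++-assoc v₀ (ℓ₁ ∷ v₁) (ℓ₂ ∷ w))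
    (next (pair (subst (λ i → Balanced i _) (+₃-solve-zero i₀+l₁≡k k+t≡0) b₀) b₁) (begin
      lead ℓ +₃ t₁ +₃ i₁ +₃ lead ℓ₂    ≡⟨ cong (_+₃ lead ℓ₂) (+₃-assoc (lead ℓ) t₁ i₁) ⟩
      lead ℓ +₃ (t₁ +₃ i₁) +₃ lead ℓ₂  ≡⟨ +₃-assoc (lead ℓ) _ (lead ℓ₂) ⟩
      lead ℓ +₃ (t₁ +₃ i₁ +₃ lead ℓ₂)  ≡⟨ cong (lead ℓ +₃_) t₁+i₁+l₂≡k₁ ⟩
      lead ℓ +₃ k₁                     ≡⟨ +₃-comm (lead ℓ) k₁ ⟩
      k₁ +₃ lead ℓ                     ∎) π)
  where open ≡-Reasoning

parse-letter : ∀ ℓ e {w} → Parse 0₃ w (blocks e) → Parse 0₃ (ℓ ∷ w) (blocks (letter· ℓ e))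
parse-letter ℓ e {w} π with y·-view (z^· (trail ℓ) e)
... | y-pushed pushed = subst (Parse 0₃ (ℓ ∷ w)) (sym (begin
  blocks (z^· (lead ℓ) (y· e′))
    ≡⟨ blocks-z^· (lead ℓ) (y· e′) ⟩
  head (blocks (y· e′)) +₃ lead ℓ ∷ tail (blocks (y· e′))
    ≡⟨ cong (λ bs → head bs +₃ lead ℓ ∷ tail bs) pushed ⟩
  lead ℓ ∷ toList (blocks e′)
    ≡⟨ cong (λ bs → lead ℓ ∷ toList bs) (blocks-z^· (trail ℓ) e) ⟩
  lead ℓ ∷ head (blocks e) +₃ trail ℓ ∷ tail (blocks e)
    ∎))
  (parse-push ℓ π)
  where
  open ≡-Reasoning
  e′ = z^· (trail ℓ) e
... | y-cancels {k₁} {ks} cancelling popped = subst (Parse 0₃ (ℓ ∷ w))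
  (sym (trans (blocks-z^· (lead ℓ) (y· e′)) (cong (λ bs → head bs +₃ lead ℓ ∷ tail bs) popped)))
  (parse-pop ℓ (cong head split) (subst (λ ks′ → Parse 0₃ w (head (blocks e) ∷ ks′)) (cong tail split) π))
  where
  e′ = z^· (trail ℓ) e
  split : head (blocks e) +₃ trail ℓ ∷ tail (blocks e) ≡ 0₃ ∷ k₁ ∷ ks
  split = trans (sym (blocks-z^· (trail ℓ) e)) cancelling

parse : ∀ w → Parse 0₃ w (blocks (image (interp w)))
parse []      = last [] refl
parse (ℓ ∷ w) = subst (λ e → Parse 0₃ (ℓ ∷ w) (blocks e))
  (sym (trans (act-++ (interpLetter ℓ) (interp w) one) (act-letter ℓ (image (interp w)))))
  (parse-letter ℓ (image (interp w)) (parse w))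

-- y z^(trail ℓ) z^i z^(lead ℓ′) y = 1 for the i of a matched pair
act-matched : ∀ ℓ ℓ′ v e →
              act (interpLetter ℓ ++ zWord (-₃ (trail ℓ +₃ lead ℓ′)) ++ interpLetter ℓ′ ++ v) e ≡
              z^· (lead ℓ) (z^· (trail ℓ′) (act v e))
act-matched ℓ ℓ′ v e = begin
  act (interpLetter ℓ ++ zWord i ++ interpLetter ℓ′ ++ v) e
    ≡⟨ trans (act-++ (interpLetter ℓ) _ e) (act-letter ℓ _) ⟩
  letter· ℓ (act (zWord i ++ interpLetter ℓ′ ++ v) e)
    ≡⟨ cong (letter· ℓ) (trans (act-++ (zWord i) _ e) (act-zWord i _)) ⟩
  letter· ℓ (z^· i (act (interpLetter ℓ′ ++ v) e))
    ≡⟨ cong (letter· ℓ ∘ z^· i) (trans (act-++ (interpLetter ℓ′) v e) (act-letter ℓ′ _)) ⟩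
  z^· l (y· (z^· t (z^· i (z^· l′ (y· (z^· t′ (act v e)))))))
    ≡⟨ cong (λ e′ → z^· l (y· (z^· t e′))) (z^·-+ i l′ _) ⟩
  z^· l (y· (z^· t (z^· (i +₃ l′) (y· (z^· t′ (act v e))))))
    ≡⟨ cong (λ e′ → z^· l (y· e′)) (z^·-+ t (i +₃ l′) _) ⟩
  z^· l (y· (z^· (t +₃ (i +₃ l′)) (y· (z^· t′ (act v e)))))
    ≡⟨ cong (λ a → z^· l (y· (z^· a (y· (z^· t′ (act v e)))))) t+[i+l′]≡0 ⟩
  z^· l (y· (y· (z^· t′ (act v e))))
    ≡⟨ cong (z^· l) (y·-involutive _) ⟩
  z^· l (z^· t′ (act v e))
    ∎
  where
  open ≡-Reasoning
  l  = lead ℓ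
  t  = trail ℓ
  l′ = lead ℓ′
  t′ = trail ℓ′
  i  = -₃ (t +₃ l′)
  t+[i+l′]≡0 : t +₃ (i +₃ l′) ≡ 0₃
  t+[i+l′]≡0 = trans (cong (t +₃_) (+₃-comm i l′))
                     (trans (sym (+₃-assoc t l′ i)) (+₃-inverseʳ (t +₃ l′)))

act-next : ∀ p k ℓ k′ ks e →
           act (zWord (-₃ p +₃ (k -₃ lead ℓ)) ++ interpLetter ℓ ++ blockWord (-₃ trail ℓ +₃ k′) ks) e
             ≡ act (blockWord (-₃ p +₃ k) (k′ ∷ ks)) e
act-next p k ℓ k′ ks e = begin
  act (zWord a ++ interpLetter ℓ ++ blockWord b ks) e
    ≡⟨ trans (act-++ (zWord a) _ e) (act-zWord a _) ⟩
  z^· a (act (interpLetter ℓ ++ blockWord b ks) e)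
    ≡⟨ cong (z^· a) (trans (act-++ (interpLetter ℓ) _ e) (act-letter ℓ _)) ⟩
  z^· a (z^· (lead ℓ) (y· (z^· (trail ℓ) (act (blockWord b ks) e))))
    ≡⟨ cong (λ e′ → z^· a (z^· (lead ℓ) (y· (z^· (trail ℓ) e′)))) (act-blockWord b ks e) ⟩
  z^· a (z^· (lead ℓ) (y· (z^· (trail ℓ) (z^· b T))))
    ≡⟨ cong (λ e′ → z^· a (z^· (lead ℓ) (y· e′))) (z^·-+ (trail ℓ) b T) ⟩
  z^· a (z^· (lead ℓ) (y· (z^· (trail ℓ +₃ b) T)))
    ≡⟨ z^·-+ a (lead ℓ) _ ⟩
  z^· (a +₃ lead ℓ) (y· (z^· (trail ℓ +₃ b) T))
    ≡⟨ cong₂ (λ c c′ → z^· c (y· (z^· c′ T))) a+l≡c t+b≡k′ ⟩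
  z^· c (y· (z^· k′ T))
    ≡⟨ cong (λ e′ → z^· c (y· e′)) (act-blockWord k′ ks e) ⟨
  z^· c (y· (act (blockWord k′ ks) e))
    ≡⟨ cong (z^· c) (trans (act-++ (syllableWord Y) (blockWord k′ ks) e) (act-syllableWord Y _)) ⟨
  z^· c (act (tailWord (k′ ∷ ks)) e)
    ≡⟨ act-blockWord c (k′ ∷ ks) e ⟨
  act (blockWord c (k′ ∷ ks)) e
    ∎
  where
  open ≡-Reasoning
  a = -₃ p +₃ (k -₃ lead ℓ)
  b = -₃ trail ℓ +₃ k′
  c = -₃ p +₃ k
  T = act (tailWord ks) e
  a+l≡c : a +₃ lead ℓ ≡ c
  a+l≡c = trans (+₃-assoc (-₃ p) _ (lead ℓ)) (cong (-₃ p +₃_) (+₃-Group.//-rightDividesˡ (lead ℓ) k))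
  t+b≡k′ : trail ℓ +₃ b ≡ k′
  t+b≡k′ = +₃-Group.\\-leftDividesˡ (trail ℓ) k′

evalForm : {A : Set} → (A → BraidWord) → List (A ⊎ Letter) → BraidWord
evalForm rep []           = []
evalForm rep (inj₁ A ∷ γ) = rep A ++ evalForm rep γ
evalForm rep (inj₂ ℓ ∷ γ) = interpLetter ℓ ++ evalForm rep γ

evalForm-++ : ∀ {A : Set} (rep : A → BraidWord) γ γ′ →
              evalForm rep (γ ++ γ′) ≡ evalForm rep γ ++ evalForm rep γ′
evalForm-++ rep []           γ′ = refl
evalForm-++ rep (inj₁ A ∷ γ) γ′ =
  trans (cong (rep A ++_) (evalForm-++ rep γ γ′)) (sym (++-assoc (rep A) _ _))
evalForm-++ rep (inj₂ ℓ ∷ γ) γ′ =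
  trans (cong (interpLetter ℓ ++_) (evalForm-++ rep γ γ′)) (sym (++-assoc (interpLetter ℓ) _ _))

evalForm-terminals : ∀ {A : Set} (rep : A → BraidWord) w → evalForm rep (map inj₂ w) ≡ interp w
evalForm-terminals rep []      = refl
evalForm-terminals rep (ℓ ∷ w) = cong (interpLetter ℓ ++_) (evalForm-terminals rep w)

module Derivations {k : ℕ} {T : Set} (G : ValenceGrammar k T) where
  open ValenceGrammar G

  Form : Set
  Form = List (Fin n ⊎ T)

  cast : ∀ {a a′ b b′} → a ≡ a′ → b ≡ b′ → Star (Step G) a b → Star (Step G) a′ b′
  cast refl refl s = s

  Derives : Form → List T → Vec ℤ k → Set
  Derives γ w c = ∀ α α′ r →
    Star (Step G) (α ++ γ ++ α′ , r) (α ++ map inj₂ w ++ α′ , r +ᵛ c)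

  derives-[] : Derives [] [] 0ᵛ
  derives-[] α α′ r = cast refl (cong (α ++ α′ ,_) (sym (zipWith-identityʳ ℤ.+-identityʳ r))) ε

  derives-terminal : ∀ t → Derives (inj₂ t ∷ []) (t ∷ []) 0ᵛ
  derives-terminal t α α′ r =
    cast refl (cong (α ++ inj₂ t ∷ α′ ,_) (sym (zipWith-identityʳ ℤ.+-identityʳ r))) ε

  derives-++ : ∀ {γ₁ γ₂ w₁ w₂ c₁ c₂} → Derives γ₁ w₁ c₁ → Derives γ₂ w₂ c₂ →
               Derives (γ₁ ++ γ₂) (w₁ ++ w₂) (c₁ +ᵛ c₂)
  derives-++ {γ₁} {γ₂} {w₁} {w₂} {c₁} {c₂} d₁ d₂ α α′ r =
    cast (cong (λ γ → α ++ γ , r) (sym (++-assoc γ₁ γ₂ α′)))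
         (cong₂ _,_ terminals (zipWith-assoc ℤ.+-assoc r c₁ c₂))
         (d₁ α (γ₂ ++ α′) r ◅◅
          cast (cong (_, _) (++-assoc α _ _)) refl (d₂ (α ++ map inj₂ w₁) α′ (r +ᵛ c₁)))
    where
    terminals : (α ++ map inj₂ w₁) ++ map inj₂ w₂ ++ α′ ≡ α ++ map inj₂ (w₁ ++ w₂) ++ α′
    terminals = trans (++-assoc α _ _) (cong (α ++_)
      (trans (sym (++-assoc (map inj₂ w₁) _ α′)) (cong (_++ α′) (sym (map-++ inj₂ w₁ w₂)))))

  derives-rule : ∀ {A γ x w c} → (A , γ , x) ∈ rules → Derives γ w c →
                 Derives (inj₁ A ∷ []) w (x +ᵛ c)
  derives-rule {x = x} {w} {c} A→γ d α α′ r = step α α′ r A→γ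
    ◅ cast refl (cong (α ++ map inj₂ w ++ α′ ,_) (zipWith-assoc ℤ.+-assoc r x c)) (d α α′ (r +ᵛ x))

-- grammars whose rules hold in B₃ up to the centre, a valence x standing for Δ^(2x)
module CentralSoundness (G : ValenceGrammar 1 Letter) (rep : Fin (ValenceGrammar.n G) → BraidWord) where
  open ValenceGrammar G
  open Derivations G

  ⟦_⟧ : Form → BraidWord
  ⟦_⟧ = evalForm rep

  Sound : Fin n × Form × Vec ℤ 1 → Set
  Sound (A , γ , x) = ⟦ γ ⟧ ≈ rep A ++ center^ (Vec.head x)

  module _ (rules-sound : All Sound rules) where

    Invariant : Config G → Set
    Invariant (γ , r) = ⟦ γ ⟧ ≈ rep start ++ center^ (Vec.head r)

    step-invariant : ∀ {c c′} → Step G c c′ → Invariant c → Invariant c′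
    step-invariant (step {A} {γ} {x} α α′ r A→γ) inv = begin
      ⟦ α ++ γ ++ α′ ⟧
        ≡⟨ trans (evalForm-++ rep α _) (cong (⟦ α ⟧ ++_) (evalForm-++ rep γ α′)) ⟩
      ⟦ α ⟧ ++ ⟦ γ ⟧ ++ ⟦ α′ ⟧
        ≈⟨ ≈B-cong ⟦ α ⟧ ⟦ α′ ⟧ (lookup rules-sound A→γ) ⟩
      ⟦ α ⟧ ++ (rep A ++ center^ a) ++ ⟦ α′ ⟧
        ≡⟨ cong (⟦ α ⟧ ++_) (++-assoc (rep A) _ _) ⟩
      ⟦ α ⟧ ++ rep A ++ center^ a ++ ⟦ α′ ⟧
        ≈⟨ ≈B-congˡ ⟦ α ⟧ (≈B-congˡ (rep A) (center^-central a ⟦ α′ ⟧)) ⟩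
      ⟦ α ⟧ ++ rep A ++ ⟦ α′ ⟧ ++ center^ a
        ≡⟨ cong (⟦ α ⟧ ++_) (++-assoc (rep A) _ _) ⟨
      ⟦ α ⟧ ++ (rep A ++ ⟦ α′ ⟧) ++ center^ a
        ≡⟨ ++-assoc ⟦ α ⟧ _ _ ⟨
      (⟦ α ⟧ ++ rep A ++ ⟦ α′ ⟧) ++ center^ a
        ≡⟨ cong (_++ center^ a) (evalForm-++ rep α (inj₁ A ∷ α′)) ⟨
      ⟦ α ++ inj₁ A ∷ α′ ⟧ ++ center^ a
        ≈⟨ ≈B-congʳ (center^ a) inv ⟩
      (rep start ++ center^ b) ++ center^ a
        ≡⟨ ++-assoc (rep start) _ _ ⟩
      rep start ++ center^ b ++ center^ a
        ≈⟨ ≈B-congˡ (rep start) (center^-+ b a) ⟩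
      rep start ++ center^ (b + a)
        ≡⟨ cong (λ c → rep start ++ center^ c) (head-+ᵛ r x) ⟨
      rep start ++ center^ (Vec.head (r +ᵛ x))
        ∎
      where
      open ≈-Reasoning hiding (start)
      a = Vec.head x
      b = Vec.head r
      head-+ᵛ : ∀ (r x : Vec ℤ 1) → Vec.head (r +ᵛ x) ≡ Vec.head r + Vec.head x
      head-+ᵛ (_ Vec.∷ Vec.[]) (_ Vec.∷ Vec.[]) = refl

    derivation-invariant : ∀ {c c′} → Star (Step G) c c′ → Invariant c → Invariant c′
    derivation-invariant ε        inv = inv
    derivation-invariant (s ◅ ss) inv = derivation-invariant ss (step-invariant s inv)

    derived-word : ∀ {w r} → Star (Step G) (inj₁ start ∷ [] , 0ᵛ) (map inj₂ w , r) →
                   interp w ≈ rep start ++ center^ (Vec.head r)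
    derived-word {w} d = subst (_≈ _) (evalForm-terminals rep w) (derivation-invariant d ≈refl)

    language-sound : ∀ w → InLang G w → interp w ≈ rep start
    language-sound w d = ≈trans (derived-word d) (≡⇒≈ (++-identityʳ (rep start)))

    language-complete : ∀ {w c} → Derives (inj₁ start ∷ []) w c → interp w ≈ rep start → InLang G w
    language-complete {w} {a Vec.∷ Vec.[]} d w≈S =
      cast refl (cong (λ x → map inj₂ w , x Vec.∷ Vec.[]) 0+a≡0) derivation
      where
      derivation : Star (Step G) (inj₁ start ∷ [] , 0ᵛ) (map inj₂ w , 0ᵛ +ᵛ (a Vec.∷ Vec.[]))
      derivation = cast refl (cong (_, _) (++-identityʳ (map inj₂ w))) (d [] [] 0ᵛ)
      0+a≡0 : 0ℤ + a ≡ 0ℤ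
      0+a≡0 = center^-cancelʳ (rep start) (0ℤ + a) (≈trans (≈sym (derived-word derivation)) w≈S)

residues : List ℤ₃
residues = 0₃ ∷ 1₃ ∷ 2₃ ∷ []

∈-residues : ∀ k → k ∈ residues
∈-residues 0₃ = here refl
∈-residues 1₃ = there (here refl)
∈-residues 2₃ = there (there (here refl))

letters : List Letter
letters = σ₁ ∷ σ₂ ∷ Δ ∷ Δ⁻¹ ∷ []

∈-letters : ∀ ℓ → ℓ ∈ letters
∈-letters σ₁  = here refl
∈-letters σ₂  = there (here refl)
∈-letters Δ   = there (there (here refl))
∈-letters Δ⁻¹ = there (there (there (here refl)))

toℕ₃ : ℤ₃ → ℕ
toℕ₃ 0₃ = 0
toℕ₃ 1₃ = 1
toℕ₃ 2₃ = 2

data Nonterminal : Set where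
  axiom    : Nonterminal
  balanced : ℤ₃ → Nonterminal
  suffix   : ℕ → ℤ₃ → Nonterminal

suffixIndex : ℕ → ℤ₃ → ℕ
suffixIndex zero    p = toℕ₃ p
suffixIndex (suc d) p = 3 ℕ.+ suffixIndex d p

index : Nonterminal → ℕ
index axiom        = 0
index (balanced k) = suc (toℕ₃ k)
index (suffix d p) = 4 ℕ.+ suffixIndex d p

fromSuffixIndex : ℕ → Nonterminal
fromSuffixIndex 0 = suffix 0 0₃
fromSuffixIndex 1 = suffix 0 1₃
fromSuffixIndex 2 = suffix 0 2₃
fromSuffixIndex (suc (suc (suc q))) with fromSuffixIndex q
... | suffix d p = suffix (suc d) p
... | X          = X

fromIndex : ℕ → Nonterminal
fromIndex 0 = axiom
fromIndex 1 = balanced 0₃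
fromIndex 2 = balanced 1₃
fromIndex 3 = balanced 2₃
fromIndex (suc (suc (suc (suc q)))) = fromSuffixIndex q

fromIndex-index : ∀ X → fromIndex (index X) ≡ X
fromIndex-index axiom         = refl
fromIndex-index (balanced 0₃) = refl
fromIndex-index (balanced 1₃) = refl
fromIndex-index (balanced 2₃) = refl
fromIndex-index (suffix d p)  = fromSuffixIndex-suffixIndex d p
  where
  fromSuffixIndex-suffixIndex : ∀ d p → fromSuffixIndex (suffixIndex d p) ≡ suffix d p
  fromSuffixIndex-suffixIndex zero    0₃ = refl
  fromSuffixIndex-suffixIndex zero    1₃ = refl
  fromSuffixIndex-suffixIndex zero    2₃ = refl
  fromSuffixIndex-suffixIndex (suc d) p rewrite fromSuffixIndex-suffixIndex d p = refl

suffixIndex-≤ : ∀ {d D} p → d ≤ D → suffixIndex d p ≤ suffixIndex D 2₃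
suffixIndex-≤ {zero}  {zero}  0₃ z≤n = z≤n
suffixIndex-≤ {zero}  {zero}  1₃ z≤n = s≤s z≤n
suffixIndex-≤ {zero}  {zero}  2₃ z≤n = s≤s (s≤s z≤n)
suffixIndex-≤ {zero}  {suc D} p  z≤n = ℕ.m≤n⇒m≤o+n 3 (suffixIndex-≤ {D = D} p z≤n)
suffixIndex-≤ {suc d} p (s≤s d≤D)    = s≤s (s≤s (s≤s (suffixIndex-≤ p d≤D)))

clamp : ∀ N → ℕ → Fin (suc N)
clamp N       zero    = fzero
clamp zero    (suc i) = fzero
clamp (suc N) (suc i) = fsuc (clamp N i)

toℕ-clamp : ∀ {N i} → i ≤ N → toℕ (clamp N i) ≡ i
toℕ-clamp {N}     {zero}  z≤n       = refl
toℕ-clamp {suc N} {suc i} (s≤s i≤N) = cong suc (toℕ-clamp i≤N)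

suffixAt : {A : Set} → ℕ → A → List A → List⁺ A
suffixAt zero    k ks        = k ∷ ks
suffixAt (suc d) k []        = k ∷ []
suffixAt (suc d) k (k′ ∷ ks) = suffixAt d k′ ks

suffixAt-suc : ∀ {A : Set} d {k k₁ k′ : A} {ks ks′} →
               suffixAt d k ks ≡ k₁ ∷ k′ ∷ ks′ → suffixAt (suc d) k ks ≡ k′ ∷ ks′
suffixAt-suc zero    refl = refl
suffixAt-suc (suc d) {ks = []}    ()
suffixAt-suc (suc d) {ks = _ ∷ _} eq = suffixAt-suc d eq

module BraidGrammar (β : BraidWord) where

  k₀ : ℤ₃
  k₀ = head (blocks (image β))

  ks₀ : List ℤ₃
  ks₀ = tail (blocks (image β))

  m N : ℕ
  m = length ks₀
  N = index (suffix (suc m) 2₃)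

  -- balanced k derives the words with image z^k; suffix d p those w with
  -- z^p · image w equal to the reduced form of β's image from its d-th block on
  rep : Nonterminal → BraidWord
  rep axiom        = β
  rep (balanced k) = zWord k
  rep (suffix d p) = blockWord (-₃ p +₃ head (suffixAt d k₀ ks₀)) (tail (suffixAt d k₀ ks₀))

  Production : Set
  Production = Nonterminal × List (Nonterminal ⊎ Letter)

  axiomProduction : Production
  axiomProduction = axiom , inj₁ (suffix 0 0₃) ∷ []

  emptyProduction : Production
  emptyProduction = balanced 0₃ , []

  pairProduction : Letter → Letter × ℤ₃ → Production
  pairProduction ℓ (ℓ′ , j) = balanced (lead ℓ +₃ trail ℓ′ +₃ j) ,
    inj₂ ℓ ∷ inj₁ (balanced (-₃ (trail ℓ +₃ lead ℓ′))) ∷ inj₂ ℓ′ ∷ inj₁ (balanced j) ∷ []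

  lastProduction : ℕ → ℤ₃ → ℤ₃ → Production
  lastProduction d k p = suffix d p , inj₁ (balanced (-₃ p +₃ k)) ∷ []

  nextProduction : ℕ → ℤ₃ → ℤ₃ → Letter → Production
  nextProduction d k p ℓ = suffix d p ,
    inj₁ (balanced (-₃ p +₃ (k -₃ lead ℓ))) ∷ inj₂ ℓ ∷ inj₁ (suffix (suc d) (trail ℓ)) ∷ []

  balancedProductions : List Production
  balancedProductions =
    emptyProduction ∷ cartesianProductWith pairProduction letters (cartesianProduct letters residues)

  suffixProductions : ℕ → ℤ₃ → List ℤ₃ → List Production
  suffixProductions d k []        = map (lastProduction d k) residues
  suffixProductions d k (k′ ∷ ks) =
    cartesianProductWith (nextProduction d k) residues letters ++ suffixProductions (suc d) k′ ks

  productions : List Production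
  productions = axiomProduction ∷ balancedProductions ++ suffixProductions 0 k₀ ks₀

  nt : Nonterminal → Fin (suc N)
  nt X = clamp N (index X)

  -- the valence is the power of Δ² by which γ and X differ in B₃
  encode : Production → Fin (suc N) × List (Fin (suc N) ⊎ Letter) × Vec ℤ 1
  encode (X , γ) = nt X , map (Sum.map₁ nt) γ , Vec.[ centralPart (evalForm rep γ) - centralPart (rep X) ]

  grammar : ValenceGrammar 1 Letter
  grammar = record { n = suc N ; rules = map encode productions ; start = nt axiom }

  open Derivations grammar

  derives-production : ∀ {X γ w c} → (X , γ) ∈ productions → Derives (map (Sum.map₁ nt) γ) w c →
                       ∃[ c′ ] Derives (inj₁ (nt X) ∷ []) w c′
  derives-production X→γ d = _ , derives-rule (∈-map⁺ encode X→γ) d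

  balanced∈productions : ∀ {π} → π ∈ balancedProductions → π ∈ productions
  balanced∈productions = there ∘ ∈-++⁺ˡ {xs = balancedProductions} {ys = suffixProductions 0 k₀ ks₀}

  derives-balanced : ∀ {k w} → Balanced k w → ∃[ c ] Derives (inj₁ (nt (balanced k)) ∷ []) w c
  derives-balanced [] = derives-production (balanced∈productions (here refl)) derives-[]
  derives-balanced (pair {ℓ} {ℓ′} {j = j} b b′) = derives-production
    (balanced∈productions (there (∈-cartesianProductWith⁺ pairProduction
      (∈-letters ℓ) (∈-cartesianProduct⁺ (∈-letters ℓ′) (∈-residues j)))))
    (derives-++ (derives-terminal ℓ) (derives-++ (proj₂ (derives-balanced b))
      (derives-++ (derives-terminal ℓ′) (proj₂ (derives-balanced b′)))))

  derives-suffix : ∀ {d p w k ks} → (∀ {π} → π ∈ suffixProductions d k ks → π ∈ productions) →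
                   Parse p w (k ∷ ks) → ∃[ c ] Derives (inj₁ (nt (suffix d p)) ∷ []) w c
  derives-suffix {d} {p} {k = k} ⊆productions (last b p+i≡k) = derives-production
    (⊆productions (∈-map⁺ (lastProduction d k) (∈-residues p)))
    (proj₂ (derives-balanced (subst (λ i → Balanced i _) (+₃-solveʳ p p+i≡k) b)))
  derives-suffix {d} {p} {k = k} ⊆productions (next {ℓ = ℓ} b p+i+l≡k π) = derives-production
    (⊆productions (∈-++⁺ˡ (∈-cartesianProductWith⁺ (nextProduction d k) (∈-residues p) (∈-letters ℓ))))
    (derives-++ (proj₂ (derives-balanced (subst (λ i → Balanced i _) i≡ b)))
      (derives-++ (derives-terminal ℓ) (proj₂ (derives-suffix (⊆productions ∘ ∈-++⁺ʳ _) π))))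
    where i≡ = +₃-solveʳ p (+₃-solveˡ (lead ℓ) p+i+l≡k)

  derives : ∀ w → interp w ≈ β → ∃[ c ] Derives (inj₁ (nt axiom) ∷ []) w c
  derives w w≈β = derives-production (here refl)
    (proj₂ (derives-suffix (there ∘ ∈-++⁺ʳ balancedProductions)
                           (subst (λ e → Parse 0₃ w (blocks e)) (act-≈ w≈β one) (parse w))))

  repᶠ : Fin (suc N) → BraidWord
  repᶠ i = rep (fromIndex (toℕ i))

  open CentralSoundness grammar repᶠ

  Small : Nonterminal → Set
  Small X = index X ≤ N

  SmallSymbol : Nonterminal ⊎ Letter → Set
  SmallSymbol (inj₁ X) = Small X
  SmallSymbol (inj₂ ℓ) = ⊤

  small-balanced : ∀ k → Small (balanced k)
  small-balanced 0₃ = s≤s z≤n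
  small-balanced 1₃ = s≤s (s≤s z≤n)
  small-balanced 2₃ = s≤s (s≤s (s≤s z≤n))

  small-suffix : ∀ {d} p → d ≤ suc m → Small (suffix d p)
  small-suffix p d≤1+m = s≤s (s≤s (s≤s (s≤s (suffixIndex-≤ p d≤1+m))))

  repᶠ-nt : ∀ X → Small X → repᶠ (nt X) ≡ rep X
  repᶠ-nt X small = trans (cong (rep ∘ fromIndex) (toℕ-clamp small)) (cong rep (fromIndex-index X))

  evalForm-nt : ∀ {γ} → All SmallSymbol γ → evalForm repᶠ (map (Sum.map₁ nt) γ) ≡ evalForm rep γ
  evalForm-nt {[]}         []       = refl
  evalForm-nt {inj₁ X ∷ γ} (s ∷ ss) = cong₂ _++_ (repᶠ-nt X s) (evalForm-nt ss)
  evalForm-nt {inj₂ ℓ ∷ γ} (_ ∷ ss) = cong (interpLetter ℓ ++_) (evalForm-nt ss)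

  encode-sound : ∀ X γ → Small X → All SmallSymbol γ →
                 image (evalForm rep γ) ≡ image (rep X) → Sound (encode (X , γ))
  encode-sound X γ small-X small-γ same =
    subst₂ (λ u v → u ≈ v ++ center^ (centralPart (evalForm rep γ) - centralPart (rep X)))
      (sym (evalForm-nt small-γ)) (sym (repᶠ-nt X small-X)) (image-≡⇒≈ (evalForm rep γ) (rep X) same)

  rep-suffix : ∀ d {k ks} p → suffixAt d k₀ ks₀ ≡ k ∷ ks →
               rep (suffix d p) ≡ blockWord (-₃ p +₃ k) ks
  rep-suffix d p eq = cong (λ bs → blockWord (-₃ p +₃ head bs) (tail bs)) eq

  axiom-sound : Sound (encode axiomProduction)
  axiom-sound = encode-sound axiom (inj₁ (suffix 0 0₃) ∷ []) z≤n (small-suffix 0₃ z≤n ∷ [])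
    (trans (cong image (++-identityʳ (word (image β)))) (image-word (image β)))

  empty-sound : Sound (encode emptyProduction)
  empty-sound = encode-sound (balanced 0₃) [] (small-balanced 0₃) [] refl

  pair-sound : ∀ ℓ q → Sound (encode (pairProduction ℓ q))
  pair-sound ℓ (ℓ′ , j) = encode-sound (balanced (lead ℓ +₃ trail ℓ′ +₃ j))
    (inj₂ ℓ ∷ inj₁ (balanced (-₃ (trail ℓ +₃ lead ℓ′))) ∷ inj₂ ℓ′ ∷ inj₁ (balanced j) ∷ [])
    (small-balanced _) (tt ∷ small-balanced _ ∷ tt ∷ small-balanced j ∷ []) (begin
      act (interpLetter ℓ ++ zWord (-₃ (trail ℓ +₃ lead ℓ′)) ++ interpLetter ℓ′ ++ zWord j ++ []) one
        ≡⟨ act-matched ℓ ℓ′ (zWord j ++ []) one ⟩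
      z^· (lead ℓ) (z^· (trail ℓ′) (image (zWord j ++ [])))
        ≡⟨ cong (z^· (lead ℓ) ∘ z^· (trail ℓ′)) (trans (cong image (++-identityʳ (zWord j))) (act-zWord j one)) ⟩
      z^· (lead ℓ) (z^· (trail ℓ′) (z^· j one))
        ≡⟨ trans (cong (z^· (lead ℓ)) (z^·-+ (trail ℓ′) j one)) (z^·-+ (lead ℓ) _ one) ⟩
      z^· (lead ℓ +₃ (trail ℓ′ +₃ j)) one
        ≡⟨ cong (λ k → z^· k one) (+₃-assoc (lead ℓ) (trail ℓ′) j) ⟨
      z^· (lead ℓ +₃ trail ℓ′ +₃ j) one
        ≡⟨ act-zWord (lead ℓ +₃ trail ℓ′ +₃ j) one ⟨
      image (zWord (lead ℓ +₃ trail ℓ′ +₃ j))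
        ∎)
    where open ≡-Reasoning

  last-sound : ∀ {d k} p → d ≤ suc m → suffixAt d k₀ ks₀ ≡ k ∷ [] →
               Sound (encode (lastProduction d k p))
  last-sound {d} {k} p d≤1+m eq = encode-sound (suffix d p) (inj₁ (balanced (-₃ p +₃ k)) ∷ [])
    (small-suffix p d≤1+m) (small-balanced _ ∷ []) (cong image (sym (rep-suffix d p eq)))

  next-sound : ∀ {d k k′ ks} p ℓ → d ≤ m → suffixAt d k₀ ks₀ ≡ k ∷ k′ ∷ ks →
               Sound (encode (nextProduction d k p ℓ))
  next-sound {d} {k} {k′} {ks} p ℓ d≤m eq = encode-sound (suffix d p)
    (inj₁ (balanced a) ∷ inj₂ ℓ ∷ inj₁ (suffix (suc d) (trail ℓ)) ∷ [])
    (small-suffix p (ℕ.m≤n⇒m≤1+n d≤m))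
    (small-balanced a ∷ tt ∷ small-suffix (trail ℓ) (s≤s d≤m) ∷ []) (begin
      image (zWord a ++ interpLetter ℓ ++ rep (suffix (suc d) (trail ℓ)) ++ [])
        ≡⟨ cong (λ u → image (zWord a ++ interpLetter ℓ ++ u))
                (trans (++-identityʳ _) (rep-suffix (suc d) (trail ℓ) (suffixAt-suc d eq))) ⟩
      image (zWord a ++ interpLetter ℓ ++ blockWord (-₃ trail ℓ +₃ k′) ks)
        ≡⟨ act-next p k ℓ k′ ks one ⟩
      image (blockWord (-₃ p +₃ k) (k′ ∷ ks))
        ≡⟨ cong image (rep-suffix d p eq) ⟨
      image (rep (suffix d p))
        ∎)
    where
    open ≡-Reasoning
    a = -₃ p +₃ (k -₃ lead ℓ)

  suffix-sound : ∀ d k ks → d ℕ.+ length ks ≡ m → suffixAt d k₀ ks₀ ≡ k ∷ ks →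
                 All (Sound ∘ encode) (suffixProductions d k ks)
  suffix-sound d k [] d+0≡m eq =
    map⁺ {xs = residues} {f = lastProduction d k}
      (universal (λ p → last-sound p (ℕ.m≤n⇒m≤1+n d≤m) eq) residues)
    where d≤m = subst (d ≤_) d+0≡m (ℕ.m≤m+n d 0)
  suffix-sound d k (k′ ∷ ks) d+l≡m eq = ++⁺
    (cartesianProductWith⁺ (≡.setoid ℤ₃) (≡.setoid Letter) (nextProduction d k) residues letters
      (λ {p} {ℓ} _ _ → next-sound p ℓ d≤m eq))
    (suffix-sound (suc d) k′ ks (trans (sym (ℕ.+-suc d (length ks))) d+l≡m) (suffixAt-suc d eq))
    where d≤m = subst (d ≤_) d+l≡m (ℕ.m≤m+n d (suc (length ks)))

  rules-sound : All Sound (map encode productions)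
  rules-sound = map⁺ {xs = productions} {f = encode} (axiom-sound ∷ ++⁺
    (empty-sound ∷ cartesianProductWith⁺ (≡.setoid Letter) (≡.setoid (Letter × ℤ₃)) pairProduction
                     letters (cartesianProduct letters residues) (λ {ℓ} {q} _ _ → pair-sound ℓ q))
    (suffix-sound 0 k₀ ks₀ refl refl))

lemma10 : (β : BraidWord) →
    Σ[ G ∈ ValenceGrammar 1 Letter ]
      ((w : List Letter) → (InLang G w → interp w ≈B β) × (interp w ≈B β → InLang G w))
lemma10 β = grammar , λ w →
  language-sound rules-sound w , λ w≈β → language-complete rules-sound (proj₂ (derives w w≈β)) w≈β
  where
  open BraidGrammar β
  open CentralSoundness grammar repᶠ
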